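{- Let $L\subseteq\mathbb{A}^n$ be a language with $L\times L\subseteq\mathcal{R}^n$. If $m\ge3$, or $t_{\mathrm{top}}$ is odd, or $\min(r_{\mathrm{top}},s_{\mathrm{top}})<t_{\mathrm{top}}$, then $|L|\le(t_{\mathrm{top}}+1)^n$. If $m=2$, $t_{\mathrm{top}}$ is even and $r_{\mathrm{top}}=s_{\mathrm{top}}=t_{\mathrm{top}}$, then $|L|\le(t_{\mathrm{top}}+2)^n$.
   Context: Standing assumptions: $\sigma,\rho\subseteq\mathbb{Z}_{\ge0}$ are finite non-empty sets with $\rho\neq\{0\}$, $(\sigma,\rho)$ is $m$-structured for an integer $m\ge2$ (all elements of $\sigma$ pairwise congruent mod $m$, and likewise for $\rho$). $s_{\mathrm{top}}=\max\sigma$, $r_{\mathrm{top}}=\max\rho$, $t_{\mathrm{top}}=\max(r_{\mathrm{top}},s_{\mathrm{top}})$, and $\mathbb{A}=\{\sigma_0,\dots,\sigma_{s_{\mathrm{top}}},\rho_0,\dots,\rho_{r_{\mathrm{top}}}\}$ (formal symbols). For $x\in\mathbb{A}^n$, $\vec s(x)\in\{0,1\}^n$ has $\vec s(x)[i]=1$ iff $x[i]\in\{\sigma_0,\dots,\sigma_{s_{\mathrm{top}}}\}$, and $\vec w_m(x)\in\mathbb{Z}_m^n$ has $\vec w_m(x)[i]=c\bmod m$ where $x[i]\in\{\sigma_c,\rho_c\}$. $\mathcal{R}^n=\{(x,y)\in\mathbb{A}^n\times\mathbb{A}^n:\vec s(x)\cdot\vec w_m(y)\equiv\vec s(y)\cdot\vec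 w_m(x)\pmod m\}$. -}

module Defs where

open import Data.Nat using (ℕ; zero; suc; _+_; _*_; _⊔_; _%_; _≡ᵇ_; NonZero)
open import Data.Fin using (Fin; toℕ)
open import Data.Sum using (_⊎_; inj₁; inj₂)
open import Data.Vec using (Vec; []; _∷_)
open import Data.List using (List; foldr)
open import Relation.Binary.PropositionalEquality using (_≡_)

maxL : List ℕ → ℕ
maxL = foldr _⊔_ 0

-- The alphabet 𝔸 = {σ_0,…,σ_stop, ρ_0,…,ρ_rtop}:
-- inj₁ c stands for σ_c, inj₂ c stands for ρ_c.
Alphabet : ℕ → ℕ → Set
Alphabet stop rtop = Fin (suc stop) ⊎ Fin (suc rtop)

Word : ℕ → ℕ → ℕ → Set
Word stop rtop n = Vec (Alphabet stop rtop) n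

sBit : ∀ {stop rtop} → Alphabet stop rtop → ℕ
sBit (inj₁ _) = 1
sBit (inj₂ _) = 0

idx : ∀ {stop rtop} → Alphabet stop rtop → ℕ
idx (inj₁ c) = toℕ c
idx (inj₂ c) = toℕ c

-- s(x) · w_m(y), computed in ℕ (with w_m(y)[i] = idx(y[i]) mod m);
-- only its residue mod m matters
dotSW : ∀ {stop rtop n} (m : ℕ) .{{_ : NonZero m}} →
        Word stop rtop n → Word stop rtop n → ℕ
dotSW m [] [] = 0
dotSW m (a ∷ x) (b ∷ y) = sBit a * (idx b % m) + dotSW m x y

InR : ∀ {stop rtop n} (m : ℕ) .{{_ : NonZero m}} →
      Word stop rtop n → Word stop rtop n → Set
InR m x y = dotSW m x y % m ≡ dotSW m y x % m

-- Choose greedily, from the first position on, a set I of positions: j ∈ I iff two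
-- words of L whose s-bits agree on I below j have different s-bits at j. Encode each
-- letter σ_c / ρ_c by its index c outside I (at most t_top + 1 values) and by its
-- s-bit together with ⌊c/m⌋ on I (at most ⌊r_top/m⌋ + ⌊s_top/m⌋ + 2 values). Two
-- words x, y of L with the same code have the same s-vector, so x·z = y·z and hence
-- z·x ≡ z·y (mod m) for every z ∈ L by 𝓡. Their residues w_m agree off I; at j ∈ I they
-- agree by downward induction, since for the two words z₁, z₂ of L splitting j the
-- sum (s(z₁) - s(z₂)) · (w_m(x) - w_m(y)), which is ≡ 0 (mod m), reduces to
-- w_m(x)[j] - w_m(y)[j]. So the code is injective on L, and the bounds reduce to
-- estimates of ⌊r_top/m⌋ + ⌊s_top/m⌋ + 2.

module Submission where

open import Defs
open import Data.Bool using (Bool; true; false)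
open import Data.Empty using (⊥-elim)
open import Data.Fin as Fin using (Fin; zero; suc; toℕ; fromℕ<; funToFin; finToFun)
open import Data.Fin.Induction using (>-wellFounded)
open import Data.Fin.Properties
  using (toℕ-injective; toℕ<n; toℕ≤pred[n]; toℕ-fromℕ<; <-cmp; finToFun-funToFin; injective⇒≤)
import Data.Fin.Properties as Finₚ
open import Data.List using (List; _∷_; length; lookup)
open import Data.List.Membership.Propositional using (_∈_)
open import Data.List.Membership.Propositional.Properties using (∈-lookup)
open import Data.List.Properties using (foldr-preservesᵒ)
open import Data.List.Relation.Unary.All as All using ()
open import Data.List.Relation.Unary.AllPairs using (_∷_)
open import Data.List.Relation.Unary.Any as Any using ()
open import Data.List.Relation.Unary.Unique.Propositional using (Unique)
open import Data.Nat using (ℕ; zero; suc; _≤_; _<_; _^_; _%_; _/_; _⊓_; _⊔_; _+_; _*_; NonZero; z≤n; s≤s; s≤s⁻¹; z<s; _≤?_)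
open import Data.Nat.DivMod
open import Data.Nat.Properties hiding (<-cmp)
open import Data.Nat.Tactic.RingSolver using (solve-∀)
open import Algebra.Properties.CommutativeSemigroup +-commutativeSemigroup using () renaming (interchange to +-interchange)
open import Data.Product using (Σ; ∃; _×_; _,_; proj₁; proj₂)
open import Data.Sum using (_⊎_; inj₁; inj₂; [_,_])
open import Data.Vec as Vec using ([]; _∷_)
open import Data.Vec.Properties using (tabulate∘lookup; tabulate-cong)
open import Data.Vec.Functional using (updateAt)
open import Data.Vec.Functional.Properties using (updateAt-updates; updateAt-minimal)
open import Effect.Monad using (RawMonad)
open import Function using (_∘_; const)
open import Induction.WellFounded as WF using ()
open import Level using (0ℓ)
open import Relation.Binary.Definitions using (tri<; tri≈; tri>)
open import Relation.Binary.PropositionalEquality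
  using (_≡_; _≢_; refl; sym; trans; cong; cong₂; subst; module ≡-Reasoning)
open import Relation.Nullary using (¬_; yes; no; contradiction)
open import Relation.Nullary.Decidable using (¬¬-excluded-middle; decidable-stable)
open import Relation.Nullary.Negation using (¬¬-Monad)

lookup-injective : ∀ {A : Set} {xs : List A} → Unique xs → ∀ {i j} → lookup xs i ≡ lookup xs j → i ≡ j
lookup-injective {xs = _ ∷ _} _            {zero}  {zero}  _  = refl
lookup-injective {xs = _ ∷ _} (x∉xs ∷ _)   {zero}  {suc j} eq = contradiction eq (All.lookup x∉xs (∈-lookup j))
lookup-injective {xs = _ ∷ _} (x∉xs ∷ _)   {suc i} {zero}  eq = contradiction (sym eq) (All.lookup x∉xs (∈-lookup i))
lookup-injective {xs = _ ∷ _} (_ ∷ unique) {suc i} {suc j} eq = cong suc (lookup-injective unique eq)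

length≤^ : ∀ {A : Set} {xs : List A} {B n} (code : A → Fin n → ℕ) → Unique xs →
           (∀ x j → code x j < B) →
           (∀ {x y} → x ∈ xs → y ∈ xs → (∀ j → code x j ≡ code y j) → x ≡ y) →
           length xs ≤ B ^ n
length≤^ {A} {xs} {B} {n} code unique bounded injectiveOn = injective⇒≤ index-injective
  where
  finCode : A → Fin n → Fin B
  finCode x j = fromℕ< (bounded x j)

  index : Fin (length xs) → Fin (B ^ n)
  index i = funToFin (finCode (lookup xs i))

  decode : ∀ x j → toℕ (finToFun (funToFin (finCode x)) j) ≡ code x j
  decode x j = trans (cong toℕ (finToFun-funToFin (finCode x) j)) (toℕ-fromℕ< (bounded x j))

  index-injective : ∀ {i i′} → index i ≡ index i′ → i ≡ i′
  index-injective {i} {i′} eq = lookup-injective unique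
    (injectiveOn (∈-lookup i) (∈-lookup i′) λ j →
      trans (sym (decode _ j)) (trans (cong (λ c → toℕ (finToFun c j)) eq) (decode _ j)))

%-/-injective : ∀ {u v} m .{{_ : NonZero m}} → u % m ≡ v % m → u / m ≡ v / m → u ≡ v
%-/-injective {u} {v} m r≡ q≡ = begin
  u                   ≡⟨ m≡m%n+[m/n]*n u m ⟩
  u % m + u / m * m   ≡⟨ cong₂ (λ r q → r + q * m) r≡ q≡ ⟩
  v % m + v / m * m   ≡⟨ m≡m%n+[m/n]*n v m ⟨
  v                   ∎
  where open ≡-Reasoning

%-cong-+ : ∀ {a a′ b b′} m .{{_ : NonZero m}} → a % m ≡ a′ % m → b % m ≡ b′ % m → (a + b) % m ≡ (a′ + b′) % m
%-cong-+ {a} {a′} {b} {b′} m a≡ b≡ = begin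
  (a + b) % m             ≡⟨ %-distribˡ-+ a b m ⟩
  (a % m + b % m) % m     ≡⟨ cong₂ (λ u v → (u + v) % m) a≡ b≡ ⟩
  (a′ % m + b′ % m) % m   ≡⟨ %-distribˡ-+ a′ b′ m ⟨
  (a′ + b′) % m           ∎
  where open ≡-Reasoning

+-cancel-% : ∀ {x y a b} m .{{_ : NonZero m}} → x % m ≡ y % m → x + a ≡ y + b → a % m ≡ b % m
+-cancel-% {x} {y} {a} {b} m x≡y eq = begin
  a % m               ≡⟨ [m+kn]%n≡m%n a (x / m) m ⟨
  (a + x / m * m) % m ≡⟨ cong (_% m) (+-cancelˡ-≡ (x % m) _ _ quotients) ⟩
  (b + y / m * m) % m ≡⟨ [m+kn]%n≡m%n b (y / m) m ⟩
  b % m               ∎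
  where
  open ≡-Reasoning
  split : ∀ z c → z % m + (c + z / m * m) ≡ z + c
  split z c = begin
    z % m + (c + z / m * m) ≡⟨ cong (z % m +_) (+-comm c _) ⟩
    z % m + (z / m * m + c) ≡⟨ +-assoc (z % m) _ c ⟨
    z % m + z / m * m + c   ≡⟨ cong (_+ c) (m≡m%n+[m/n]*n z m) ⟨
    z + c                   ∎
  quotients : x % m + (a + x / m * m) ≡ x % m + (b + y / m * m)
  quotients = begin
    x % m + (a + x / m * m) ≡⟨ split x a ⟩
    x + a                   ≡⟨ eq ⟩
    y + b                   ≡⟨ split y b ⟨
    y % m + (b + y / m * m) ≡⟨ cong (_+ (b + y / m * m)) x≡y ⟨
    x % m + (b + y / m * m) ∎

maxL-upperBound : ∀ {a} xs → a ∈ xs → a ≤ maxL xs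
maxL-upperBound xs a∈xs =
  foldr-preservesᵒ (λ x y → [ m≤n⇒m≤n⊔o y , m≤n⇒m≤o⊔n x ]) 0 xs (inj₂ (Any.map ≤-reflexive a∈xs))

maxL-positive : ∀ ρ → ¬ (∀ a → a ∈ ρ → a ≡ 0) → 1 ≤ maxL ρ
maxL-positive ρ ¬all-zero with maxL ρ in max≡
... | zero  = contradiction (λ a a∈ρ → n≤0⇒n≡0 (subst (a ≤_) max≡ (maxL-upperBound ρ a∈ρ))) ¬all-zero
... | suc _ = s≤s z≤n

+-⊓-⊔ : ∀ (f : ℕ → ℕ) r s → f r + f s ≡ f (r ⊓ s) + f (r ⊔ s)
+-⊓-⊔ f r s with ≤-total r s
... | inj₁ r≤s rewrite m≤n⇒m⊓n≡m r≤s | m≤n⇒m⊔n≡n r≤s = refl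
... | inj₂ s≤r rewrite m≥n⇒m⊓n≡n s≤r | m≥n⇒m⊔n≡m s≤r = +-comm (f r) (f s)

n+n≡n*2 : ∀ n → n + n ≡ n * 2
n+n≡n*2 n = sym (trans (*-suc n 1) (cong (n +_) (*-identityʳ n)))

halves-sum≤ : ∀ a b {u} → a * 2 ≤ u → b * 2 ≤ suc u → a + b ≤ u
halves-sum≤ a b {u} a≤ b≤ = s≤s⁻¹ (*-cancelʳ-< 2 (a + b) (suc u) (begin-strict
  (a + b) * 2   ≡⟨ *-distribʳ-+ 2 a b ⟩
  a * 2 + b * 2 ≤⟨ +-mono-≤ a≤ b≤ ⟩
  u + suc u     <⟨ +-monoˡ-< (suc u) ≤-refl ⟩
  suc u + suc u ≡⟨ n+n≡n*2 (suc u) ⟩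
  suc u * 2     ∎))
  where open ≤-Reasoning

module QuotientBounds (m : ℕ) .{{_ : NonZero m}} (2≤m : 2 ≤ m) where

  /-≤-half : ∀ {a b} → a ≤ b → a / m ≤ b / 2
  /-≤-half {a} {b} a≤b = ≤-trans (/-monoˡ-≤ m a≤b) (/-monoʳ-≤ b 2≤m)

  quotients≤⊔ : ∀ r s → r / m + s / m ≤ r ⊔ s
  quotients≤⊔ r s = ≤-trans (+-mono-≤ (/-≤-half (m≤m⊔n r s)) (/-≤-half (m≤n⊔m r s)))
                            (halves-sum≤ (t / 2) (t / 2) (m/n*n≤m t 2) (m≤n⇒m≤1+n (m/n*n≤m t 2)))
    where t = r ⊔ s

  quotients<⊔ : ∀ r s → 1 ≤ r ⊔ s → 3 ≤ m ⊎ (r ⊔ s) % 2 ≡ 1 ⊎ r ⊓ s < r ⊔ s →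
                r / m + s / m < r ⊔ s
  quotients<⊔ r s t≥1 (inj₁ 3≤m) = ≤-<-trans (+-mono-≤ (/-monoˡ-≤ m (m≤m⊔n r s)) (/-monoˡ-≤ m (m≤n⊔m r s)))
                                             (double<t (t / m) (≤-trans (*-monoʳ-≤ (t / m) 3≤m) (m/n*n≤m t m)))
    where
    t = r ⊔ s
    triple : ∀ k → k * 3 ≡ k + k + k
    triple = solve-∀
    double<t : ∀ k → k * 3 ≤ t → k + k < t
    double<t zero    _    = t≥1
    double<t (suc k) 3k≤t = <-≤-trans (m<m+n _ z<s) (≤-trans (≤-reflexive (sym (triple (suc k)))) 3k≤t)
  quotients<⊔ r s _ (inj₂ (inj₁ t-odd)) = begin-strict
    r / m + s / m   ≤⟨ +-mono-≤ (/-≤-half (m≤m⊔n r s)) (/-≤-half (m≤n⊔m r s)) ⟩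
    t / 2 + t / 2   ≡⟨ n+n≡n*2 (t / 2) ⟩
    t / 2 * 2       <⟨ n<1+n _ ⟩
    1 + t / 2 * 2   ≡⟨ cong (_+ t / 2 * 2) t-odd ⟨
    t % 2 + t / 2 * 2 ≡⟨ m≡m%n+[m/n]*n t 2 ⟨
    t               ∎
    where
    open ≤-Reasoning
    t = r ⊔ s
  quotients<⊔ r s _ (inj₂ (inj₂ ⊓<⊔)) rewrite +-⊓-⊔ (_/ m) r s = below (r ⊓ s) (r ⊔ s) ⊓<⊔
    where
    below : ∀ a b → a < b → a / m + b / m < b
    below a (suc b) (s≤s a≤b) = s≤s (≤-trans (+-mono-≤ (/-≤-half a≤b) (/-≤-half (≤-refl {suc b})))
                                             (halves-sum≤ (b / 2) (suc b / 2) (m/n*n≤m b 2) (m/n*n≤m (suc b) 2)))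

sAt : ∀ {st rt n} → Word st rt n → Fin n → ℕ
sAt x j = sBit (Vec.lookup x j)

module DotProduct (m : ℕ) .{{_ : NonZero m}} {st rt : ℕ} where

  w : Alphabet st rt → ℕ
  w a = idx a % m

  wAt : ∀ {n} → Word st rt n → Fin n → ℕ
  wAt x j = w (Vec.lookup x j)

  dotSW-congˡ : ∀ {n} (x y z : Word st rt n) → (∀ j → sAt x j ≡ sAt y j) → dotSW m x z ≡ dotSW m y z
  dotSW-congˡ []      []      []      _ = refl
  dotSW-congˡ (a ∷ x) (b ∷ y) (c ∷ z) s≡ =
    cong₂ _+_ (cong (_* w c) (s≡ zero)) (dotSW-congˡ x y z (s≡ ∘ suc))

  Exchangeable : ∀ {n} (z₁ z₂ x y : Word st rt n) → Fin n → Set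
  Exchangeable z₁ z₂ x y l = wAt x l ≡ wAt y l ⊎ sAt z₁ l ≡ sAt z₂ l

  private
    exchange-head : ∀ s₁ s₂ a b → a ≡ b ⊎ s₁ ≡ s₂ → s₁ * a + s₂ * b ≡ s₁ * b + s₂ * a
    exchange-head s₁ s₂ a b (inj₁ refl) = refl
    exchange-head s₁ s₂ a b (inj₂ refl) = +-comm (s₁ * a) (s₁ * b)

  dotSW-exchange : ∀ {n} (z₁ z₂ x y : Word st rt n) → (∀ l → Exchangeable z₁ z₂ x y l) →
                   dotSW m z₁ x + dotSW m z₂ y ≡ dotSW m z₁ y + dotSW m z₂ x
  dotSW-exchange []        []        []      []      _ = refl
  dotSW-exchange (a₁ ∷ z₁) (a₂ ∷ z₂) (b ∷ x) (c ∷ y) ex = begin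
    (s₁ * w b + dotSW m z₁ x) + (s₂ * w c + dotSW m z₂ y)
      ≡⟨ +-interchange (s₁ * w b) _ _ _ ⟩
    (s₁ * w b + s₂ * w c) + (dotSW m z₁ x + dotSW m z₂ y)
      ≡⟨ cong₂ _+_ (exchange-head s₁ s₂ _ _ (ex zero)) (dotSW-exchange z₁ z₂ x y (ex ∘ suc)) ⟩
    (s₁ * w c + s₂ * w b) + (dotSW m z₁ y + dotSW m z₂ x)
      ≡⟨ +-interchange (s₁ * w c) _ _ _ ⟩
    (s₁ * w c + dotSW m z₁ y) + (s₂ * w b + dotSW m z₂ x) ∎
    where
    open ≡-Reasoning
    s₁ = sBit a₁
    s₂ = sBit a₂

  dotSW-exchange-except : ∀ {n} (z₁ z₂ x y : Word st rt n) j → (∀ l → l ≢ j → Exchangeable z₁ z₂ x y l) →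
                          sAt z₁ j ≡ 1 → sAt z₂ j ≡ 0 →
                          dotSW m z₁ x + dotSW m z₂ y + wAt y j ≡ dotSW m z₁ y + dotSW m z₂ x + wAt x j
  dotSW-exchange-except (a₁ ∷ z₁) (a₂ ∷ z₂) (b ∷ x) (c ∷ y) zero ex s₁≡1 s₂≡0 rewrite s₁≡1 | s₂≡0 = begin
    (1 * w b + dotSW m z₁ x) + (0 * w c + dotSW m z₂ y) + w c
      ≡⟨ regroup (w b) (w c) _ _ ⟩
    (dotSW m z₁ x + dotSW m z₂ y) + (w b + w c)
      ≡⟨ cong₂ _+_ (dotSW-exchange z₁ z₂ x y λ l → ex (suc l) λ ()) (+-comm (w b) (w c)) ⟩
    (dotSW m z₁ y + dotSW m z₂ x) + (w c + w b)
      ≡⟨ regroup (w c) (w b) _ _ ⟨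
    (1 * w c + dotSW m z₁ y) + (0 * w b + dotSW m z₂ x) + w b ∎
    where
    open ≡-Reasoning
    regroup : ∀ p q u v → (1 * p + u) + (0 * q + v) + q ≡ (u + v) + (p + q)
    regroup = solve-∀
  dotSW-exchange-except (a₁ ∷ z₁) (a₂ ∷ z₂) (b ∷ x) (c ∷ y) (suc j) ex s₁≡1 s₂≡0 = begin
    (s₁ * w b + dotSW m z₁ x) + (s₂ * w c + dotSW m z₂ y) + wAt y j
      ≡⟨ regroup (s₁ * w b) _ _ _ _ ⟩
    (s₁ * w b + s₂ * w c) + (dotSW m z₁ x + dotSW m z₂ y + wAt y j)
      ≡⟨ cong₂ _+_ (exchange-head s₁ s₂ _ _ (ex zero λ ()))
                   (dotSW-exchange-except z₁ z₂ x y j (λ l l≢j → ex (suc l) (l≢j ∘ Finₚ.suc-injective)) s₁≡1 s₂≡0) ⟩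
    (s₁ * w c + s₂ * w b) + (dotSW m z₁ y + dotSW m z₂ x + wAt x j)
      ≡⟨ regroup (s₁ * w c) _ _ _ _ ⟨
    (s₁ * w c + dotSW m z₁ y) + (s₂ * w b + dotSW m z₂ x) + wAt x j ∎
    where
    open ≡-Reasoning
    s₁ = sBit a₁
    s₂ = sBit a₂
    regroup : ∀ a b c d e → (a + b) + (c + d) + e ≡ (a + c) + (b + d + e)
    regroup = solve-∀

module Selection {st rt n : ℕ} (L : List (Word st rt n)) where

  open RawMonad (¬¬-Monad {a = 0ℓ}) using (pure; _>>=_)

  AgreeBelow : (Fin n → Bool) → Fin n → Word st rt n → Word st rt n → Set
  AgreeBelow I j x y = ∀ {l} → l Fin.< j → I l ≡ true → sAt x l ≡ sAt y l

  record Splits (I : Fin n → Bool) (j : Fin n) : Set where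
    constructor splits
    field
      {z₁ z₂} : Word st rt n
      z₁∈L    : z₁ ∈ L
      z₂∈L    : z₂ ∈ L
      agree   : AgreeBelow I j z₁ z₂
      z₁[j]∈σ : sAt z₁ j ≡ 1
      z₂[j]∈ρ : sAt z₂ j ≡ 0

  Uniform : (Fin n → Bool) → Fin n → Set
  Uniform I j = ∀ x y → x ∈ L → y ∈ L → AgreeBelow I j x y → sAt x j ≡ sAt y j

  Adapted : (Fin n → Bool) → Fin n → Set
  Adapted I j = (I j ≡ true × Splits I j) ⊎ (I j ≡ false × Uniform I j)

  module _ {I I′ : Fin n → Bool} {j : Fin n} (I≡I′ : ∀ {l} → l Fin.< j → I l ≡ I′ l) where

    AgreeBelow-cong : ∀ {x y} → AgreeBelow I j x y → AgreeBelow I′ j x y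
    AgreeBelow-cong agree l<j I′l = agree l<j (trans (I≡I′ l<j) I′l)

    Splits-cong : Splits I j → Splits I′ j
    Splits-cong (splits {z₁} {z₂} z₁∈L z₂∈L agree z₁[j]∈σ z₂[j]∈ρ) =
      splits z₁∈L z₂∈L (AgreeBelow-cong {z₁} {z₂} agree) z₁[j]∈σ z₂[j]∈ρ

    Uniform-cong : Uniform I j → Uniform I′ j
    Uniform-cong uniform x y x∈L y∈L agree = uniform x y x∈L y∈L (λ l<j Il → agree l<j (trans (sym (I≡I′ l<j)) Il))

  Adapted-cong : ∀ {I I′ j} → (∀ {l} → l Fin.≤ j → I l ≡ I′ l) → Adapted I j → Adapted I′ j
  Adapted-cong I≡I′ (inj₁ (Ij , split))   = inj₁ (trans (sym (I≡I′ ≤-refl)) Ij , Splits-cong (I≡I′ ∘ <⇒≤) split)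
  Adapted-cong I≡I′ (inj₂ (Ij , uniform)) = inj₂ (trans (sym (I≡I′ ≤-refl)) Ij , Uniform-cong (I≡I′ ∘ <⇒≤) uniform)

  ¬uniform⇒¬¬splits : ∀ {I j} → ¬ Uniform I j → ¬ ¬ Splits I j
  ¬uniform⇒¬¬splits {I} {j} ¬uniform ¬splits = ¬uniform uniform
    where
    uniform : Uniform I j
    uniform x y x∈L y∈L agree with Vec.lookup x j in x[j] | Vec.lookup y j in y[j]
    ... | inj₁ _ | inj₁ _ = refl
    ... | inj₂ _ | inj₂ _ = refl
    ... | inj₁ _ | inj₂ _ = ⊥-elim (¬splits (splits x∈L y∈L agree (cong sBit x[j]) (cong sBit y[j])))
    ... | inj₂ _ | inj₁ _ = ⊥-elim (¬splits (splits y∈L x∈L (λ l<j Il → sym (agree l<j Il)) (cong sBit y[j]) (cong sBit x[j])))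

  setAt : (Fin n → Bool) → Fin n → Bool → Fin n → Bool
  setAt I f b = updateAt I f (const b)

  setAt-below : ∀ I {f l} b → l Fin.< f → I l ≡ setAt I f b l
  setAt-below I {f} {l} b l<f = sym (updateAt-minimal l f I (Finₚ.<⇒≢ l<f))

  adaptedAt : ∀ I f → ¬ ¬ Σ Bool λ b → Adapted (setAt I f b) f
  adaptedAt I f = ¬¬-excluded-middle {A = Uniform I f} >>= λ where
    (yes uniform) → pure (false , inj₂ (updateAt-updates f I , Uniform-cong (setAt-below I false) uniform))
    (no ¬uniform) → ¬uniform⇒¬¬splits ¬uniform >>= λ split →
                      pure (true , inj₁ (updateAt-updates f I , Splits-cong (setAt-below I true) split))

  AdaptedBelow : ℕ → (Fin n → Bool) → Set
  AdaptedBelow k I = ∀ j → toℕ j < k → Adapted I j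

  adaptedBelow-extend : ∀ {k I} (k<n : k < n) b → AdaptedBelow k I →
                        Adapted (setAt I (fromℕ< k<n) b) (fromℕ< k<n) →
                        AdaptedBelow (suc k) (setAt I (fromℕ< k<n) b)
  adaptedBelow-extend {I = I} k<n b adapted adapted-k j j<1+k with m≤n⇒m<n∨m≡n (s≤s⁻¹ j<1+k)
  ... | inj₁ j<k  = Adapted-cong (λ l≤j → setAt-below I b (≤-<-trans l≤j j<f)) (adapted j j<k)
    where j<f = subst (toℕ j <_) (sym (toℕ-fromℕ< k<n)) j<k
  ... | inj₂ refl = subst (Adapted _) (toℕ-injective (toℕ-fromℕ< k<n)) adapted-k

  adaptedBelow : ∀ k → k ≤ n → ¬ ¬ Σ (Fin n → Bool) (AdaptedBelow k)
  adaptedBelow zero    _   = pure (const false , λ _ ())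
  adaptedBelow (suc k) k<n = do
    I , adapted   ← adaptedBelow k (<⇒≤ k<n)
    b , adapted-k ← adaptedAt I (fromℕ< k<n)
    pure (setAt I (fromℕ< k<n) b , adaptedBelow-extend k<n b adapted adapted-k)

  adaptedSelection : ¬ ¬ Σ (Fin n → Bool) λ I → ∀ j → Adapted I j
  adaptedSelection = do
    I , adapted ← adaptedBelow n ≤-refl
    pure (I , λ j → adapted j (toℕ<n j))

letter-injective : ∀ {st rt} (a b : Alphabet st rt) → sBit a ≡ sBit b → idx a ≡ idx b → a ≡ b
letter-injective (inj₁ c) (inj₁ d) _  eq = cong inj₁ (toℕ-injective eq)
letter-injective (inj₂ c) (inj₂ d) _  eq = cong inj₂ (toℕ-injective eq)
letter-injective (inj₁ c) (inj₂ d) () _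
letter-injective (inj₂ c) (inj₁ d) () _

module Encoding (m : ℕ) .{{_ : NonZero m}} {st rt : ℕ} where

  quotientCode : Alphabet st rt → ℕ
  quotientCode (inj₁ c) = suc (rt / m + toℕ c / m)
  quotientCode (inj₂ c) = toℕ c / m

  ρ-code<σ-code : ∀ c d → quotientCode (inj₂ d) < quotientCode (inj₁ c)
  ρ-code<σ-code c d = s≤s (≤-trans (/-monoˡ-≤ m (toℕ≤pred[n] d)) (m≤m+n _ _))

  quotientCode-injective : ∀ a b → quotientCode a ≡ quotientCode b → sBit a ≡ sBit b × idx a / m ≡ idx b / m
  quotientCode-injective (inj₁ c) (inj₁ d) eq = refl , +-cancelˡ-≡ (rt / m) _ _ (suc-injective eq)
  quotientCode-injective (inj₂ c) (inj₂ d) eq = refl , eq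
  quotientCode-injective (inj₁ c) (inj₂ d) eq = contradiction eq (>⇒≢ (ρ-code<σ-code c d))
  quotientCode-injective (inj₂ c) (inj₁ d) eq = contradiction eq (<⇒≢ (ρ-code<σ-code d c))

  letterCode : Bool → Alphabet st rt → ℕ
  letterCode true  = quotientCode
  letterCode false = idx

  letterCode-injective : ∀ b a a′ → letterCode b a ≡ letterCode b a′ →
                         sBit a ≡ sBit a′ → idx a % m ≡ idx a′ % m → a ≡ a′
  letterCode-injective true  a a′ eq s≡ r≡ =
    letter-injective a a′ s≡ (%-/-injective m r≡ (proj₂ (quotientCode-injective a a′ eq)))
  letterCode-injective false a a′ eq s≡ _  = letter-injective a a′ s≡ eq

  letterCode< : ∀ {B} → 2 + (rt / m + st / m) ≤ B → suc (rt ⊔ st) ≤ B → ∀ b a → letterCode b a < B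
  letterCode< q<B _   true  (inj₁ c) = <-≤-trans (s≤s (s≤s (+-monoʳ-≤ (rt / m) (/-monoˡ-≤ m (toℕ≤pred[n] c))))) q<B
  letterCode< q<B _   true  (inj₂ c) = <-≤-trans (s≤s (m≤n⇒m≤1+n (≤-trans (/-monoˡ-≤ m (toℕ≤pred[n] c)) (m≤m+n _ _)))) q<B
  letterCode< _   t<B false (inj₁ c) = <-≤-trans (s≤s (≤-trans (toℕ≤pred[n] c) (m≤n⊔m rt st))) t<B
  letterCode< _   t<B false (inj₂ c) = <-≤-trans (s≤s (≤-trans (toℕ≤pred[n] c) (m≤m⊔n rt st))) t<B

  code : ∀ {n} → (Fin n → Bool) → Word st rt n → Fin n → ℕ
  code I x j = letterCode (I j) (Vec.lookup x j)

module Compatible (m : ℕ) .{{_ : NonZero m}} {st rt n : ℕ} (L : List (Word st rt n))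
                  (compatible : ∀ x y → x ∈ L → y ∈ L → InR m x y) where

  open DotProduct m
  open Encoding m
  open Selection L

  dotSW-≡-mod : ∀ {x y z} → x ∈ L → y ∈ L → z ∈ L → (∀ j → sAt x j ≡ sAt y j) →
                dotSW m z x % m ≡ dotSW m z y % m
  dotSW-≡-mod {x} {y} {z} x∈L y∈L z∈L s≡ =
    trans (compatible z x z∈L x∈L) (trans (cong (_% m) (dotSW-congˡ x y z s≡)) (sym (compatible z y z∈L y∈L)))

  split⇒residue≡ : ∀ {I j x y} → x ∈ L → y ∈ L → (∀ l → sAt x l ≡ sAt y l) → (split : Splits I j) →
                   (∀ l → l ≢ j → Exchangeable (Splits.z₁ split) (Splits.z₂ split) x y l) →
                   wAt x j ≡ wAt y j
  split⇒residue≡ {j = j} {x} {y} x∈L y∈L s≡ (splits {z₁} {z₂} z₁∈L z₂∈L _ z₁[j]∈σ z₂[j]∈ρ) exchangeable = begin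
    wAt x j     ≡⟨ m%n%n≡m%n (idx (Vec.lookup x j)) m ⟨
    wAt x j % m ≡⟨ +-cancel-% m X≡Y-mod (dotSW-exchange-except z₁ z₂ x y j exchangeable z₁[j]∈σ z₂[j]∈ρ) ⟨
    wAt y j % m ≡⟨ m%n%n≡m%n (idx (Vec.lookup y j)) m ⟩
    wAt y j     ∎
    where
    open ≡-Reasoning
    X≡Y-mod : (dotSW m z₁ x + dotSW m z₂ y) % m ≡ (dotSW m z₁ y + dotSW m z₂ x) % m
    X≡Y-mod = %-cong-+ m (dotSW-≡-mod x∈L y∈L z₁∈L s≡) (sym (dotSW-≡-mod x∈L y∈L z₂∈L s≡))

  code-injective : ∀ I → (∀ j → Adapted I j) →
                   ∀ {x y} → x ∈ L → y ∈ L → (∀ j → code I x j ≡ code I y j) → x ≡ y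
  code-injective I adapted {x} {y} x∈L y∈L same =
    trans (sym (tabulate∘lookup x)) (trans (tabulate-cong letter≡) (tabulate∘lookup y))
    where
    same-at : ∀ {l b} → I l ≡ b → letterCode b (Vec.lookup x l) ≡ letterCode b (Vec.lookup y l)
    same-at {l} Il = subst (λ b → letterCode b (Vec.lookup x l) ≡ letterCode b (Vec.lookup y l)) Il (same l)

    s≡-on-I : ∀ {l} → I l ≡ true → sAt x l ≡ sAt y l
    s≡-on-I Il = proj₁ (quotientCode-injective _ _ (same-at Il))

    w≡-off-I : ∀ {l} → I l ≡ false → wAt x l ≡ wAt y l
    w≡-off-I Il = cong (_% m) (same-at Il)

    s≡ : ∀ j → sAt x j ≡ sAt y j
    s≡ j with adapted j
    ... | inj₁ (Ij , _)       = s≡-on-I Ij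
    ... | inj₂ (_  , uniform) = uniform x y x∈L y∈L (λ _ → s≡-on-I)

    w≡-above⇒w≡ : ∀ j → (∀ {l} → j Fin.< l → wAt x l ≡ wAt y l) → wAt x j ≡ wAt y j
    w≡-above⇒w≡ j w≡-above with adapted j
    ... | inj₂ (Ij , _)     = w≡-off-I Ij
    ... | inj₁ (_  , split) = split⇒residue≡ x∈L y∈L s≡ split exchangeable
      where
      exchangeable : ∀ l → l ≢ j → Exchangeable (Splits.z₁ split) (Splits.z₂ split) x y l
      exchangeable l l≢j with <-cmp l j | I l in Il
      ... | tri< l<j _ _ | true  = inj₂ (Splits.agree split l<j Il)
      ... | tri< _   _ _ | false = inj₁ (w≡-off-I Il)
      ... | tri≈ _ l≡j _ | _     = contradiction l≡j l≢j
      ... | tri> _ _ j<l | _     = inj₁ (w≡-above j<l)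

    w≡ : ∀ j → wAt x j ≡ wAt y j
    w≡ = WF.All.wfRec >-wellFounded _ _ w≡-above⇒w≡

    letter≡ : ∀ j → Vec.lookup x j ≡ Vec.lookup y j
    letter≡ j = letterCode-injective (I j) _ _ (same j) (s≡ j) (w≡ j)

compatible⇒length≤ : ∀ m .{{_ : NonZero m}} {st rt n} (L : List (Word st rt n)) → Unique L →
                     (∀ x y → x ∈ L → y ∈ L → InR m x y) →
                     ∀ {B} → 2 + (rt / m + st / m) ≤ B → suc (rt ⊔ st) ≤ B → length L ≤ B ^ n
-- Choosing I needs excluded middle, which is harmless since the conclusion is decidable.
compatible⇒length≤ m {n = n} L unique compatible {B} q<B t<B =
  decidable-stable (length L ≤? B ^ n) do
    I , adapted ← adaptedSelection
    pure (length≤^ (code I) unique (λ x j → letterCode< q<B t<B (I j) _) (code-injective I adapted))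
  where
  open RawMonad (¬¬-Monad {a = 0ℓ}) using (pure; _>>=_)
  open Encoding m
  open Selection L
  open Compatible m L compatible

theorem4p4 : (m : ℕ) .{{_ : NonZero m}} → 2 ≤ m →
    (σ ρ : List ℕ) →
    (∃ λ a → a ∈ σ) → (∃ λ a → a ∈ ρ) →
    ¬ (∀ a → a ∈ ρ → a ≡ 0) →
    (∀ a b → a ∈ σ → b ∈ σ → a % m ≡ b % m) →
    (∀ a b → a ∈ ρ → b ∈ ρ → a % m ≡ b % m) →
    (n : ℕ) → (L : List (Word (maxL σ) (maxL ρ) n)) → Unique L →
    (∀ x y → x ∈ L → y ∈ L → InR m x y) →
    ((3 ≤ m ⊎ (maxL ρ ⊔ maxL σ) % 2 ≡ 1 ⊎ (maxL ρ ⊓ maxL σ) < (maxL ρ ⊔ maxL σ)) →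
       length L ≤ suc (maxL ρ ⊔ maxL σ) ^ n)
    ×
    (m ≡ 2 → (maxL ρ ⊔ maxL σ) % 2 ≡ 0 → maxL ρ ≡ (maxL ρ ⊔ maxL σ) → maxL σ ≡ (maxL ρ ⊔ maxL σ) →
       length L ≤ (maxL ρ ⊔ maxL σ + 2) ^ n)
theorem4p4 m 2≤m σ ρ _ _ ρ≢0 _ _ n L unique compatible =
    (λ strict → length≤ (s≤s (quotients<⊔ r s t≥1 strict)) ≤-refl)
  , (λ _ _ _ _ → subst (λ B → length L ≤ B ^ n) (+-comm 2 t) (length≤ (+-monoʳ-≤ 2 (quotients≤⊔ r s)) (n≤1+n (suc t))))
  where
  open QuotientBounds m 2≤m
  r = maxL ρ
  s = maxL σ
  t = r ⊔ s
  t≥1 : 1 ≤ t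
  t≥1 = ≤-trans (maxL-positive ρ ρ≢0) (m≤m⊔n r s)
  length≤ : ∀ {B} → 2 + (r / m + s / m) ≤ B → suc t ≤ B → length L ≤ B ^ n
  length≤ = compatible⇒length≤ m L unique compatible
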